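{- For each integer $n\geq 2$, $\mathrm{srd}(K_n)=n-1$.
   Context: $K_n$ is the complete graph on $n$ vertices. An edge-coloring of $G$ is any map $c:E(G)\to[k]$ (adjacent edges may receive the same color). For distinct vertices $u,v$ of a connected graph $G$, a $u$-$v$-edge-cut is a set $F$ of edges such that $u$ and $v$ lie in different components of $G-F$; a minimum $u$-$v$-edge-cut is one of minimum size among these. A set of edges is rainbow if no two of its edges have the same color. An edge-colored connected graph is strong rainbow disconnected if for every two distinct vertices $u,v$ there is a $u$-$v$-edge-cut that is both rainbow and minimum; $\mathrm{srd}(G)$ is the smallest number of colors of an edge-coloring making $G$ strong rainbow disconnected. -}

module Defs where

open import Data.Nat using (ℕ; _≤_; _+_)
open import Data.Bool using (Bool; true; false; _∧_; not; if_then_else_)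
open import Data.Fin using (Fin; _<_; _<?_; _≟_)
open import Data.List using (List; map; allFin)
open import Data.Nat.ListAction using (sum)
open import Data.Product using (Σ; _×_; ∃)
open import Relation.Nullary using (¬_; ⌊_⌋)
open import Relation.Binary.PropositionalEquality using (_≡_; _≢_)
open import Relation.Binary.Construct.Closure.ReflexiveTransitive using (Star)

-- Only the values Adj i j with i < j are used: the edge {i,j} (i<j) is
-- present iff Adj i j ≡ true.  (Loops / orientation are thereby excluded.)
Graph : ℕ → Set
Graph n = Fin n → Fin n → Bool

K : (n : ℕ) → Graph n
K n i j = not ⌊ i ≟ j ⌋

module _ {n : ℕ} (G : Graph n) where

  IsEdge : Fin n → Fin n → Set
  IsEdge i j = (i < j) × (G i j ≡ true)

  isEdge : Fin n → Fin n → Bool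
  isEdge i j = ⌊ i <? j ⌋ ∧ G i j

  -- An edge set of G: F i j ≡ true (for an edge (i,j), i<j) means {i,j} ∈ F.
  -- Values of F on non-edges are irrelevant.
  EdgeSet : Set
  EdgeSet = Fin n → Fin n → Bool

  Colouring : ℕ → Set
  Colouring k = Fin n → Fin n → Fin k

  size : EdgeSet → ℕ
  size F = sum (map (λ i → sum (map (λ j → if isEdge i j ∧ F i j then 1 else 0)
                                    (allFin n)))
                    (allFin n))

  Step : EdgeSet → Fin n → Fin n → Set
  Step F x y = (IsEdge x y × F x y ≡ false) Data.Sum.⊎ (IsEdge y x × F y x ≡ false)
    where import Data.Sum

  IsCut : EdgeSet → Fin n → Fin n → Set
  IsCut F u v = ¬ Star (Step F) u v

  IsMinCut : EdgeSet → Fin n → Fin n → Set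
  IsMinCut F u v = IsCut F u v × (∀ (F' : EdgeSet) → IsCut F' u v → size F ≤ size F')

  IsRainbow : ∀ {k} → Colouring k → EdgeSet → Set
  IsRainbow c F = ∀ i j i' j' → IsEdge i j → IsEdge i' j' →
                  F i j ≡ true → F i' j' ≡ true → c i j ≡ c i' j' →
                  (i ≡ i') × (j ≡ j')

  StrongRainbowDisconnected : ∀ {k} → Colouring k → Set
  StrongRainbowDisconnected c = ∀ (u v : Fin n) → u ≢ v →
    Σ EdgeSet (λ F → IsMinCut F u v × IsRainbow c F)

  HasSRD : ℕ → Set
  HasSRD k = Σ (Colouring k) StrongRainbowDisconnected

  srd≡ : ℕ → Set
  srd≡ k = HasSRD k × (∀ k' → HasSRD k' → k ≤ k')

{-# OPTIONS --safe #-}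
-- A u–v cut F of K_n contains, for every vertex w ≠ u, the edge uw or the edge wv (otherwise
-- u w v is a path avoiding F).  These n − 1 edges are distinct, so every cut has at least n − 1
-- edges and a rainbow one needs n − 1 colours; the star at u is a cut with exactly n − 1 edges.
-- For the colouring, name the vertices 0, …, n − 2 and last, and colour {i, j} by i + j and
-- {i, last} by 2i modulo n − 1: the star at every vertex other than last is rainbow, and of any
-- two distinct vertices at least one is not last.
module Submission where

open import Defs
open import Data.Nat using (ℕ; zero; suc; _+_; _*_; _∸_; _≤_; z≤n; s≤s; NonZero)
import Data.Nat as ℕ
open import Data.Nat.Properties using (+-comm; ≤-trans; <⇒≱)
open import Data.Nat.DivMod using (_%_; _mod_; [m+kn]%n≡m%n; %-distribˡ-+; m<n⇒m%n≡m)
open import Data.Nat.Solver using (module +-*-Solver)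
open import Data.Nat.ListAction using (sum)
open import Data.Nat.ListAction.Properties using (sum-++)
open import Data.Bool using (Bool; true; false; _∧_; _∨_; if_then_else_)
import Data.Bool.Properties as Bool
open import Data.Fin using (Fin; zero; suc; toℕ; fromℕ; _<_; _<?_; _≟_; punchIn; punchOut)
open import Data.Fin.Properties
  using (injective⇒≤; <-cmp; <⇒≢; ≤∧≢⇒<; ≤fromℕ; toℕ-injective; toℕ-fromℕ; toℕ-fromℕ<;
         punchIn-injective; punchInᵢ≢i; punchIn-punchOut)
open import Data.List using (List; []; _∷_; _++_; map; length; filter; lookup; allFin; cartesianProduct)
open import Data.List.Properties using (map-∘; map-++)
open import Data.List.Membership.Propositional using (_∈_)
open import Data.List.Membership.Propositional.Properties
  using (∈-filter⁺; ∈-filter⁻; ∈-lookup; ∈-cartesianProduct⁺; ∈-allFin)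
open import Data.List.Membership.Setoid.Properties using (index-injective)
import Data.List.Relation.Unary.All as All
open import Data.List.Relation.Unary.AllPairs using (_∷_)
open import Data.List.Relation.Unary.Unique.Propositional using (Unique)
import Data.List.Relation.Unary.Unique.Propositional.Properties as Unique
open import Data.Product using (∃; _×_; _,_; proj₁; proj₂; uncurry; swap)
open import Data.Product.Properties using (,-injective)
open import Data.Sum using (_⊎_; inj₁; inj₂)
open import Data.Empty using (⊥-elim)
open import Function using (Injective)
open import Relation.Nullary using (¬_; Dec; yes; no; ⌊_⌋)
open import Relation.Binary using (tri<; tri≈; tri>)
open import Relation.Binary.PropositionalEquality
open import Relation.Binary.Construct.Closure.ReflexiveTransitive using (ε; _◅_; reverse)

lookup-injective : ∀ {A : Set} {xs : List A} → Unique xs → Injective _≡_ _≡_ (lookup xs)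
lookup-injective (_ ∷ _) {zero} {zero} _ = refl
lookup-injective (x∉xs ∷ _) {zero} {suc j} x≡xs[j] = ⊥-elim (All.lookup x∉xs (∈-lookup j) x≡xs[j])
lookup-injective (x∉xs ∷ _) {suc i} {zero} xs[i]≡x = ⊥-elim (All.lookup x∉xs (∈-lookup i) (sym xs[i]≡x))
lookup-injective (_ ∷ unique) {suc i} {suc j} eq = cong suc (lookup-injective unique eq)

sum-map-sum≡sum-cartesianProduct : ∀ {A B : Set} (f : A → B → ℕ) xs ys →
  sum (map (λ x → sum (map (f x) ys)) xs) ≡ sum (map (uncurry f) (cartesianProduct xs ys))
sum-map-sum≡sum-cartesianProduct f [] ys = refl
sum-map-sum≡sum-cartesianProduct f (x ∷ xs) ys = begin
  sum (map (f x) ys) + sum (map (λ x → sum (map (f x) ys)) xs)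
    ≡⟨ cong₂ _+_ (cong sum (map-∘ ys)) (sum-map-sum≡sum-cartesianProduct f xs ys) ⟩
  sum (map (uncurry f) (map (x ,_) ys)) + sum (map (uncurry f) (cartesianProduct xs ys))
    ≡⟨ sum-++ (map (uncurry f) (map (x ,_) ys)) _ ⟨
  sum (map (uncurry f) (map (x ,_) ys) ++ map (uncurry f) (cartesianProduct xs ys))
    ≡⟨ cong sum (map-++ (uncurry f) (map (x ,_) ys) _) ⟨
  sum (map (uncurry f) (cartesianProduct (x ∷ xs) ys)) ∎
  where open ≡-Reasoning

module _ {A : Set} (b : A → Bool) where

  count : List A → ℕ
  count xs = sum (map (λ x → if b x then 1 else 0) xs)

  private
    holds? : (x : A) → Dec (b x ≡ true)
    holds? x = b x Bool.≟ true

  count≡length-filter : ∀ xs → count xs ≡ length (filter holds? xs)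
  count≡length-filter [] = refl
  count≡length-filter (x ∷ xs) with b x
  ... | true = cong suc (count≡length-filter xs)
  ... | false = count≡length-filter xs

  injection⇒≤count : ∀ {m xs} (h : Fin m → A) → Injective _≡_ _≡_ h →
                     (∀ i → h i ∈ xs) → (∀ i → b (h i) ≡ true) → m ≤ count xs
  injection⇒≤count {xs = xs} h h-injective h∈xs bh rewrite count≡length-filter xs =
    injective⇒≤ (λ eq → h-injective (index-injective (setoid A) (position _) (position _) eq))
    where
    position : ∀ i → h i ∈ filter holds? xs
    position i = ∈-filter⁺ holds? (h∈xs i) (bh i)

  surjection⇒count≤ : ∀ {m xs} → Unique xs → (h : Fin m → A) →
                      (∀ x → x ∈ xs → b x ≡ true → ∃ λ i → h i ≡ x) → count xs ≤ m
  surjection⇒count≤ {m} {xs} unique h covers rewrite count≡length-filter xs =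
    injective⇒≤ {f = preimage} λ eq →
      lookup-injective (Unique.filter⁺ holds? unique)
        (trans (sym (proj₂ (cover _))) (trans (cong h eq) (proj₂ (cover _))))
    where
    cover : ∀ k → ∃ λ i → h i ≡ lookup (filter holds? xs) k
    cover k = let (x∈xs , bx) = ∈-filter⁻ holds? (∈-lookup k) in covers _ x∈xs bx
    preimage : Fin (length (filter holds? xs)) → Fin m
    preimage k = proj₁ (cover k)

∧≡true⇒ : ∀ {x y} → x ∧ y ≡ true → x ≡ true × y ≡ true
∧≡true⇒ {true} {true} _ = refl , refl

module _ {n : ℕ} (G : Graph n) where

  IsEdgeOf : EdgeSet G → Fin n × Fin n → Set
  IsEdgeOf F p = IsEdge G (proj₁ p) (proj₂ p) × F (proj₁ p) (proj₂ p) ≡ true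

  record DistinctEdges (F : EdgeSet G) (m : ℕ) : Set where
    field
      edgeAt : Fin m → Fin n × Fin n
      edgeAt-injective : Injective _≡_ _≡_ edgeAt
      edgeAt∈F : ∀ i → IsEdgeOf F (edgeAt i)

  IsEdge⇒isEdge : ∀ {i j} → IsEdge G i j → isEdge G i j ≡ true
  IsEdge⇒isEdge {i} {j} (i<j , e) with i <? j
  ... | yes _ = e
  ... | no i≮j = ⊥-elim (i≮j i<j)

  isEdge⇒IsEdge : ∀ {i j} → isEdge G i j ≡ true → IsEdge G i j
  isEdge⇒IsEdge {i} {j} e with i <? j
  ... | yes i<j = i<j , e

  private
    pairs : List (Fin n × Fin n)
    pairs = cartesianProduct (allFin n) (allFin n)

    inSize : EdgeSet G → Fin n × Fin n → Bool
    inSize F p = isEdge G (proj₁ p) (proj₂ p) ∧ F (proj₁ p) (proj₂ p)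

    size≡count : ∀ F → size G F ≡ count (inSize F) pairs
    size≡count F = sum-map-sum≡sum-cartesianProduct _ (allFin n) (allFin n)

  DistinctEdges⇒≤size : ∀ {F m} → DistinctEdges F m → m ≤ size G F
  DistinctEdges⇒≤size {F} D rewrite size≡count F =
    injection⇒≤count (inSize F) edgeAt edgeAt-injective
      (λ _ → ∈-cartesianProduct⁺ (∈-allFin _) (∈-allFin _))
      (λ i → let (ij∈G , ij∈F) = edgeAt∈F i in
             subst (λ b → b ∧ _ ≡ true) (sym (IsEdge⇒isEdge ij∈G)) ij∈F)
    where open DistinctEdges D

  covered⇒size≤ : ∀ {F m} (h : Fin m → Fin n × Fin n) →
                  (∀ {i j} → IsEdge G i j → F i j ≡ true → ∃ λ k → h k ≡ (i , j)) →
                  size G F ≤ m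
  covered⇒size≤ {F} h covers rewrite size≡count F =
    surjection⇒count≤ (inSize F) (Unique.cartesianProduct⁺ (Unique.allFin⁺ n) (Unique.allFin⁺ n)) h
      λ where (i , j) _ e → let (ij∈G , ij∈F) = ∧≡true⇒ e in covers (isEdge⇒IsEdge ij∈G) ij∈F

  DistinctEdges⇒≤colours : ∀ {F m k} {c : Colouring G k} → IsRainbow G c F →
                           DistinctEdges F m → m ≤ k
  DistinctEdges⇒≤colours {m = m} {k} {c} rainbow D = injective⇒≤ {f = colourAt} λ {i} {i′} eq →
    let (i∈G , i∈F) = edgeAt∈F i ; (i′∈G , i′∈F) = edgeAt∈F i′ in
    edgeAt-injective (uncurry (cong₂ _,_) (rainbow _ _ _ _ i∈G i′∈G i∈F i′∈F eq))
    where
    open DistinctEdges D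
    colourAt : Fin m → Fin k
    colourAt i = c (proj₁ (edgeAt i)) (proj₂ (edgeAt i))

  Step-sym : ∀ {F x y} → Step G F x y → Step G F y x
  Step-sym (inj₁ s) = inj₂ s
  Step-sym (inj₂ s) = inj₁ s

  IsCut-sym : ∀ {F u v} → IsCut G F u v → IsCut G F v u
  IsCut-sym {F} cut path = cut (reverse (Step-sym {F}) path)

  IsMinCut-sym : ∀ {F u v} → IsMinCut G F u v → IsMinCut G F v u
  IsMinCut-sym (cut , minimal) = IsCut-sym cut , λ F′ cut′ → minimal F′ (IsCut-sym cut′)

module _ {n : ℕ} where

  <⇒IsEdge : ∀ {i j : Fin n} → i < j → IsEdge (K n) i j
  <⇒IsEdge {i} {j} i<j with i ≟ j
  ... | yes i≡j = ⊥-elim (<⇒≢ i<j i≡j)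
  ... | no _ = i<j , refl

  edge : Fin n → Fin n → Fin n × Fin n
  edge x y with <-cmp x y
  ... | tri> _ _ _ = y , x
  ... | _ = x , y

  edge-< : ∀ {x y} → x < y → edge x y ≡ (x , y)
  edge-< {x} {y} x<y with <-cmp x y
  ... | tri< _ _ _ = refl
  ... | tri≈ _ _ _ = refl
  ... | tri> x≮y _ _ = ⊥-elim (x≮y x<y)

  edge-> : ∀ {x y} → y < x → edge x y ≡ (y , x)
  edge-> {x} {y} y<x with <-cmp x y
  ... | tri< _ _ y≮x = ⊥-elim (y≮x y<x)
  ... | tri≈ _ _ y≮x = ⊥-elim (y≮x y<x)
  ... | tri> _ _ _ = refl

  edge-endpoints : ∀ x y → edge x y ≡ (x , y) ⊎ edge x y ≡ (y , x)
  edge-endpoints x y with <-cmp x y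
  ... | tri< _ _ _ = inj₁ refl
  ... | tri≈ _ _ _ = inj₁ refl
  ... | tri> _ _ _ = inj₂ refl

  edge-injective-upToSwap : ∀ {x y x′ y′} → edge x y ≡ edge x′ y′ →
                   (x ≡ x′ × y ≡ y′) ⊎ (x ≡ y′ × y ≡ x′)
  edge-injective-upToSwap {x} {y} {x′} {y′} eq with edge-endpoints x y | edge-endpoints x′ y′
  ... | inj₁ e | inj₁ e′ = inj₁ (,-injective (trans (sym e) (trans eq e′)))
  ... | inj₁ e | inj₂ e′ = inj₂ (,-injective (trans (sym e) (trans eq e′)))
  ... | inj₂ e | inj₁ e′ = inj₂ (swap (,-injective (trans (sym e) (trans eq e′))))
  ... | inj₂ e | inj₂ e′ = inj₁ (swap (,-injective (trans (sym e) (trans eq e′))))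

  edge-IsEdge : ∀ {x y} → x ≢ y → IsEdge (K n) (proj₁ (edge x y)) (proj₂ (edge x y))
  edge-IsEdge {x} {y} x≢y with <-cmp x y
  ... | tri< x<y _ _ = <⇒IsEdge x<y
  ... | tri≈ _ x≡y _ = ⊥-elim (x≢y x≡y)
  ... | tri> _ _ y<x = <⇒IsEdge y<x

  hasEdge : EdgeSet (K n) → Fin n → Fin n → Bool
  hasEdge F x y = F (proj₁ (edge x y)) (proj₂ (edge x y))

  ¬hasEdge⇒Step : ∀ F {x y} → x ≢ y → hasEdge F x y ≡ false → Step (K n) F x y
  ¬hasEdge⇒Step F {x} {y} x≢y xy∉F with <-cmp x y
  ... | tri< x<y _ _ = inj₁ (<⇒IsEdge x<y , xy∉F)
  ... | tri≈ _ x≡y _ = ⊥-elim (x≢y x≡y)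
  ... | tri> _ _ y<x = inj₂ (<⇒IsEdge y<x , xy∉F)

module _ {n : ℕ} {F : EdgeSet (K (suc n))} {u v : Fin (suc n)}
         (u≢v : u ≢ v) (cut : IsCut (K (suc n)) F u v) where

  private
    anchor : Fin (suc n) → Fin (suc n)
    anchor w = if hasEdge F u w then u else v

    anchor∈uv : ∀ w → anchor w ≡ u ⊎ anchor w ≡ v
    anchor∈uv w with hasEdge F u w
    ... | true = inj₁ refl
    ... | false = inj₂ refl

    anchor-edge : ∀ {w} → w ≢ u → anchor w ≢ w × hasEdge F (anchor w) w ≡ true
    anchor-edge {w} w≢u with hasEdge F u w in uw
    ... | true = ≢-sym w≢u , uw
    ... | false = v≢w , vw∈F
      where
      v≢w : v ≢ w
      v≢w refl = cut (¬hasEdge⇒Step F u≢v uw ◅ ε)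
      vw∈F : hasEdge F v w ≡ true
      vw∈F with hasEdge F v w in vw
      ... | true = refl
      ... | false = ⊥-elim (cut (¬hasEdge⇒Step F (≢-sym w≢u) uw
                                 ◅ Step-sym (K (suc n)) {F} (¬hasEdge⇒Step F v≢w vw) ◅ ε))

    ≡anchor⇒≡v : ∀ {w x} → x ≢ u → x ≡ anchor w → x ≡ v
    ≡anchor⇒≡v {w} x≢u x≡a with anchor∈uv w
    ... | inj₁ a≡u = ⊥-elim (x≢u (trans x≡a a≡u))
    ... | inj₂ a≡v = trans x≡a a≡v

    anchored-edge-injective-upToSwap : ∀ {w w′} → w ≢ u → w′ ≢ u →
                              edge (anchor w) w ≡ edge (anchor w′) w′ → w ≡ w′
    anchored-edge-injective-upToSwap w≢u w′≢u eq with edge-injective-upToSwap eq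
    ... | inj₁ (_ , w≡w′) = w≡w′
    ... | inj₂ (a≡w′ , w≡a′) = trans (≡anchor⇒≡v w≢u w≡a′) (sym (≡anchor⇒≡v w′≢u (sym a≡w′)))

  cut⇒DistinctEdges : DistinctEdges (K (suc n)) F n
  cut⇒DistinctEdges = record
    { edgeAt = λ i → edge (anchor (punchIn u i)) (punchIn u i)
    ; edgeAt-injective = λ {i} {j} eq →
        punchIn-injective u i j (anchored-edge-injective-upToSwap (punchInᵢ≢i u i) (punchInᵢ≢i u j) eq)
    ; edgeAt∈F = λ i → let (a≢w , aw∈F) = anchor-edge (punchInᵢ≢i u i) in edge-IsEdge a≢w , aw∈F
    }

module _ {n : ℕ} where

  star : Fin n → EdgeSet (K n)
  star a x y = ⌊ x ≟ a ⌋ ∨ ⌊ y ≟ a ⌋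

  star-edge : ∀ {a i j} → IsEdge (K n) i j → star a i j ≡ true →
              ∃ λ w → w ≢ a × edge a w ≡ (i , j)
  star-edge {a} {i} {j} (i<j , _) ij∈F with i ≟ a | j ≟ a
  ... | yes refl | _ = j , ≢-sym (<⇒≢ i<j) , edge-< i<j
  ... | no _ | yes refl = i , <⇒≢ i<j , edge-> i<j

  star-centreˡ : ∀ a y → star a a y ≡ true
  star-centreˡ a y with a ≟ a
  ... | yes _ = refl
  ... | no a≢a = ⊥-elim (a≢a refl)

  star-centreʳ : ∀ a y → star a y a ≡ true
  star-centreʳ a y with y ≟ a | a ≟ a
  ... | yes _ | _ = refl
  ... | no _ | yes _ = refl
  ... | no _ | no a≢a = ⊥-elim (a≢a refl)

  ¬Step-star-centre : ∀ {a y} → ¬ Step (K n) (star a) a y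
  ¬Step-star-centre {a} {y} (inj₁ (_ , ay∉F)) with () ← trans (sym (star-centreˡ a y)) ay∉F
  ¬Step-star-centre {a} {y} (inj₂ (_ , ya∉F)) with () ← trans (sym (star-centreʳ a y)) ya∉F

  star-isCut : ∀ {u v} → u ≢ v → IsCut (K n) (star u) u v
  star-isCut u≢v ε = u≢v refl
  star-isCut u≢v (s ◅ _) = ¬Step-star-centre s

size-star≤ : ∀ {n} (a : Fin (suc n)) → size (K (suc n)) (star a) ≤ n
size-star≤ a = covered⇒size≤ _ (λ k → edge a (punchIn a k)) λ ij∈G ij∈F →
  let (w , w≢a , aw≡ij) = star-edge ij∈G ij∈F in
  punchOut (≢-sym w≢a) , trans (cong (edge a) (punchIn-punchOut (≢-sym w≢a))) aw≡ij

star-isMinCut : ∀ {n} {u v : Fin (suc n)} → u ≢ v → IsMinCut (K (suc n)) (star u) u v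
star-isMinCut {u = u} u≢v = star-isCut u≢v , λ F′ cut′ →
  ≤-trans (size-star≤ u) (DistinctEdges⇒≤size (K _) (cut⇒DistinctEdges u≢v cut′))

+-%-cancelˡ : ∀ a x y m .{{_ : NonZero m}} → (a + x) % m ≡ (a + y) % m → x % m ≡ y % m
+-%-cancelˡ a x y m@(suc M) ax≡ay = begin
  x % m                    ≡⟨ shift x ⟩
  ((a + x) % m + r) % m    ≡⟨ cong (λ t → (t + r) % m) ax≡ay ⟩
  ((a + y) % m + r) % m    ≡⟨ shift y ⟨
  y % m                    ∎
  where
  open ≡-Reasoning
  r : ℕ
  r = (M * a) % m
  shift : ∀ z → z % m ≡ ((a + z) % m + r) % m
  shift z = begin
    z % m                  ≡⟨ [m+kn]%n≡m%n z a m ⟨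
    (z + a * m) % m        ≡⟨ cong (_% m) (solve 3 (λ a z M → z :+ a :* (con 1 :+ M) := a :+ z :+ M :* a) refl a z M) ⟩
    (a + z + M * a) % m    ≡⟨ %-distribˡ-+ (a + z) (M * a) m ⟩
    ((a + z) % m + r) % m  ∎
    where open +-*-Solver

module _ {m : ℕ} .{{_ : NonZero m}} where

  last : Fin (suc m)
  last = fromℕ m

  toℕ<m : ∀ {x} → x ≢ last → toℕ x ℕ.< m
  toℕ<m {x} x≢last = subst (toℕ x ℕ.<_) (toℕ-fromℕ m) (≤∧≢⇒< (≤fromℕ x) x≢last)

  partner : Fin (suc m) → Fin (suc m) → Fin (suc m)
  partner a w with w ≟ last
  ... | yes _ = a
  ... | no _ = w

  partner-¬last : ∀ a {w} → w ≢ last → partner a w ≡ w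
  partner-¬last a {w} w≢last with w ≟ last
  ... | yes w≡last = ⊥-elim (w≢last w≡last)
  ... | no _ = refl

  partner<m : ∀ {a} w → a ≢ last → toℕ (partner a w) ℕ.< m
  partner<m w a≢last with w ≟ last
  ... | yes _ = toℕ<m a≢last
  ... | no w≢last = toℕ<m w≢last

  partner-injective : ∀ {a w w′} → w ≢ a → w′ ≢ a → partner a w ≡ partner a w′ → w ≡ w′
  partner-injective {a} {w} {w′} w≢a w′≢a eq with w ≟ last | w′ ≟ last
  ... | yes w≡last | yes w′≡last = trans w≡last (sym w′≡last)
  ... | yes _ | no _ = ⊥-elim (w′≢a (sym eq))
  ... | no _ | yes _ = ⊥-elim (w≢a eq)
  ... | no _ | no _ = eq

  colour : Colouring (K (suc m)) m
  colour i j = (toℕ i + toℕ (partner i j)) mod m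

  starColour : Fin (suc m) → Fin (suc m) → Fin m
  starColour a w = (toℕ a + toℕ (partner a w)) mod m

  <⇒≢last : ∀ {w a : Fin (suc m)} → w < a → w ≢ last
  <⇒≢last {a = a} w<a refl = <⇒≱ w<a (≤fromℕ a)

  colour-edge : ∀ {a w} → a ≢ last → w ≢ a →
                colour (proj₁ (edge a w)) (proj₂ (edge a w)) ≡ starColour a w
  colour-edge {a} {w} a≢last w≢a with <-cmp a w
  ... | tri< _ _ _ = refl
  ... | tri≈ _ a≡w _ = ⊥-elim (w≢a (sym a≡w))
  ... | tri> _ _ w<a = cong (_mod m) (begin
    toℕ w + toℕ (partner w a)  ≡⟨ cong (λ p → toℕ w + toℕ p) (partner-¬last w a≢last) ⟩
    toℕ w + toℕ a              ≡⟨ +-comm (toℕ w) (toℕ a) ⟩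
    toℕ a + toℕ w              ≡⟨ cong (λ p → toℕ a + toℕ p) (partner-¬last a (<⇒≢last w<a)) ⟨
    toℕ a + toℕ (partner a w)  ∎)
    where open ≡-Reasoning

  starColour-injective : ∀ {a w w′} → a ≢ last → w ≢ a → w′ ≢ a →
                         starColour a w ≡ starColour a w′ → w ≡ w′
  starColour-injective {a} {w} {w′} a≢last w≢a w′≢a eq =
    partner-injective w≢a w′≢a (toℕ-injective (begin
      toℕ (partner a w)       ≡⟨ m<n⇒m%n≡m (partner<m w a≢last) ⟨
      toℕ (partner a w) % m   ≡⟨ +-%-cancelˡ (toℕ a) _ _ m (begin
        (toℕ a + toℕ (partner a w)) % m   ≡⟨ toℕ-fromℕ< _ ⟨
        toℕ (starColour a w)              ≡⟨ cong toℕ eq ⟩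
        toℕ (starColour a w′)             ≡⟨ toℕ-fromℕ< _ ⟩
        (toℕ a + toℕ (partner a w′)) % m  ∎) ⟩
      toℕ (partner a w′) % m  ≡⟨ m<n⇒m%n≡m (partner<m w′ a≢last) ⟩
      toℕ (partner a w′)      ∎))
    where open ≡-Reasoning

  star-rainbow : ∀ {a} → a ≢ last → IsRainbow (K (suc m)) colour (star a)
  star-rainbow {a} a≢last i j i′ j′ ij∈G i′j′∈G ij∈F i′j′∈F c≡c′
    with star-edge ij∈G ij∈F | star-edge i′j′∈G i′j′∈F
  ... | w , w≢a , refl | w′ , w′≢a , refl =
    ,-injective (cong (edge a) (starColour-injective a≢last w≢a w′≢a (begin
      starColour a w    ≡⟨ colour-edge a≢last w≢a ⟨
      colour i j        ≡⟨ c≡c′ ⟩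
      colour i′ j′      ≡⟨ colour-edge a≢last w′≢a ⟩
      starColour a w′   ∎)))
    where open ≡-Reasoning

  colour-srd : StrongRainbowDisconnected (K (suc m)) colour
  colour-srd u v u≢v with u ≟ last
  ... | no u≢last = star u , star-isMinCut u≢v , star-rainbow u≢last
  ... | yes refl = star v , IsMinCut-sym (K (suc m)) (star-isMinCut (≢-sym u≢v)) , star-rainbow (≢-sym u≢v)

srd⇒≤colours : ∀ {n k} → HasSRD (K (suc (suc n))) k → suc n ≤ k
srd⇒≤colours (c , srd) with srd zero (suc zero) (λ ())
... | F , ((cut , _) , rainbow) =
  DistinctEdges⇒≤colours (K _) rainbow (cut⇒DistinctEdges (λ ()) cut)

theorem3p6 : (n : ℕ) → 2 ≤ n → srd≡ (K n) (n ∸ 1)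
theorem3p6 (suc (suc n)) (s≤s (s≤s z≤n)) = (colour , colour-srd) , λ _ → srd⇒≤colours
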